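{- Let $G=(V,E)$ be a trivalent $2$-edge-connected graph and let $A\subseteq V$ be acyclic. (a) $A$ is dependent in $M_G$ if and only if there exists $\emptyset\ne A'\subseteq A$ with $\omega(A')<\omega(V- A')$. Moreover, if $A$ is a circuit of $M_G$, then $\omega(A)+1=\omega(V- A)$. (b) $A$ is independent in $M_G$ if and only if $\omega(A')\ge\omega(V- A')$ for all $\emptyset\ne A'\subseteq A$.
   Context: Graphs are finite and undirected and may have parallel edges; trivalent means every vertex has degree $3$. $r^*$ is the rank function of the bond (cographic) matroid of $G$, the dual of the cycle matroid. For $A\subseteq V$, $\delta(A)$ is the set of edges incident to at least one vertex of $A$. $\omega(A)$ is the number of connected components of the induced subgraph $G[A]$, with $\omega(\emptyset)=0$. A vertex subset is acyclic if its induced subgraph contains no cycle; here two vertices joined by parallel edges form a cycle. The graph curve matroid $M_G$ is the matroid on $V$ whose circuits are the non-empty subsets $A\subseteq V$ that are inclusion-minimal among non-empty subsets satisfying $r^*(\delta(A))\le|A|$. -}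

module Defs where

open import Data.Bool using (Bool; true; false; _∧_; _∨_; not; if_then_else_)
open import Data.Nat using (ℕ; zero; suc; _+_; _∸_; _≤_; _<_)
open import Data.Fin using (Fin; zero; suc; toℕ)
open import Data.Fin.Subset using (Subset; ∣_∣; _∈_; _⊆_; ∁; ⊤; ⁅_⁆; Nonempty)
open import Data.Vec using (Vec; lookup; tabulate)
open import Data.Sum using (_⊎_)
open import Data.Product using (Σ; ∃; ∃-syntax; _×_; _,_)
open import Relation.Binary.PropositionalEquality using (_≡_; _≢_)
open import Relation.Nullary using (¬_; does)
open import Data.Fin using (_≟_)
open import Data.Nat using (_<ᵇ_)
open import Function using (Injective)

-- Finite loopless multigraphs: vertices Fin n, edges Fin m,
-- edge e joins src e and tgt e (parallel edges allowed).

record Graph : Set where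
  field
    n        : ℕ
    m        : ℕ
    src      : Fin m → Fin n
    tgt      : Fin m → Fin n
    loopless : ∀ e → src e ≢ tgt e

anyF : ∀ {k} → (Fin k → Bool) → Bool
anyF {zero}  f = false
anyF {suc k} f = f zero ∨ anyF (λ i → f (suc i))

countF : ∀ {k} → (Fin k → Bool) → ℕ
countF {zero}  f = 0
countF {suc k} f = (if f zero then 1 else 0) + countF (λ i → f (suc i))

iter : ∀ {a} {X : Set a} → ℕ → (X → X) → X → X
iter zero    f x = x
iter (suc k) f x = f (iter k f x)

module _ (G : Graph) where
  open Graph G

  degree : Fin n → ℕ
  degree v = countF (λ e → does (src e ≟ v)) + countF (λ e → does (tgt e ≟ v))

  Trivalent : Set
  Trivalent = ∀ v → degree v ≡ 3

  -- Connectivity in the subgraph with vertex set S and edge set F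
  -- (only edges of F with both ends in S are used).

  usable : Subset n → Subset m → Fin m → Bool
  usable S F e = lookup F e ∧ (lookup S (src e) ∧ lookup S (tgt e))

  step : Subset n → Subset m → Subset n → Subset n
  step S F R = tabulate λ v → lookup R v ∨ anyF (λ e → usable S F e ∧
                 ((lookup R (src e) ∧ does (tgt e ≟ v)) ∨
                  (lookup R (tgt e) ∧ does (src e ≟ v))))

  -- vertices reachable from u (by a walk in (S,F)); n steps suffice
  reach : Subset n → Subset m → Fin n → Subset n
  reach S F u = iter n (step S F) ⁅ u ⁆

  connected : Subset n → Subset m → Fin n → Fin n → Bool
  connected S F u v = lookup (reach S F u) v

  -- number of connected components of (S,F): count the vertices of S
  -- that are the least vertex (in the order of Fin n) of their component
  components : Subset n → Subset m → ℕ
  components S F = countF λ v → lookup S v ∧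
                     not (anyF λ w → (toℕ w <ᵇ toℕ v) ∧ lookup S w ∧ connected S F w v)

  ω : Subset n → ℕ
  ω A = components A ⊤

  TwoEdgeConnected : Set
  TwoEdgeConnected =
    (∀ u v → connected ⊤ ⊤ u v ≡ true) ×
    (∀ e u v → connected ⊤ (∁ ⁅ e ⁆) u v ≡ true)

  -- Cycle matroid rank r(F) = |V| - c(V,F), and the bond (dual) matroid
  -- rank r*(X) = |X| + r(E - X) - r(E).

  rank : Subset m → ℕ
  rank F = n ∸ components ⊤ F

  rank* : Subset m → ℕ
  rank* X = (∣ X ∣ + rank (∁ X)) ∸ rank ⊤

  δ : Subset n → Subset m
  δ A = tabulate λ e → lookup A (src e) ∨ lookup A (tgt e)

  Cond : Subset n → Set
  Cond A = rank* (δ A) ≤ ∣ A ∣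

  IsCircuit : Subset n → Set
  IsCircuit A = Nonempty A × Cond A ×
                (∀ B → Nonempty B → B ⊆ A → Cond B → B ≡ A)

  Dependent : Subset n → Set
  Dependent A = ∃[ C ] (C ⊆ A × IsCircuit C)

  Independent : Subset n → Set
  Independent A = ¬ Dependent A

  -- A cycle of length k ≥ 2: distinct vertices vs 0..k-1 in A and distinct
  -- edges es 0..k-1, with es i joining vs i and vs (i+1 mod k).
  -- (k = 2 gives two parallel edges.)

  -- cyclic successor on Fin (suc k): i ↦ i+1, last ↦ 0
  nextF : ∀ {k} → Fin (suc k) → Fin (suc k)
  nextF {zero}  zero    = zero
  nextF {suc k} zero    = suc zero
  nextF {suc k} (suc i) with nextF {k} i
  ... | zero  = zero
  ... | suc j = suc (suc j)

  joins : Fin m → Fin n → Fin n → Set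
  joins e a b = (src e ≡ a × tgt e ≡ b) ⊎ (src e ≡ b × tgt e ≡ a)

  record CycleIn (A : Subset n) : Set where
    field
      k       : ℕ
      len≥2   : 1 ≤ k
      vs      : Fin (suc k) → Fin n
      es      : Fin (suc k) → Fin m
      vs-inj  : Injective _≡_ _≡_ vs
      es-inj  : Injective _≡_ _≡_ es
      vs∈A    : ∀ i → vs i ∈ A
      es-join : ∀ i → joins (es i) (vs i) (vs (nextF i))

  Acyclic : Subset n → Set
  Acyclic A = ¬ CycleIn A

-- Counting edge ends gives |δ(A)| + |E(A)| = 3|A|, and G[A] is a forest, so
-- |E(A)| = |A| - ω(A) and |δ(A)| = 2|A| + ω(A). Deleting δ(A) isolates the vertices
-- of A and leaves G[V - A], which has ω(V - A) components. Hence
--   r*(δ(A)) = |δ(A)| + (|V| - |A| - ω(V - A)) - (|V| - 1) = |A| + ω(A) + 1 - ω(V - A),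
-- so r*(δ(A)) ≤ |A| iff ω(A) < ω(V - A). Subsets of A are acyclic too, and every
-- non-empty set with this property contains a minimal one, which gives (a) and (b).
-- For a circuit A with ω(V - A) ≥ ω(A) + 2, removing one vertex from A keeps
-- r*(δ(-)) ≤ |-| (r* is monotone), against minimality; if A is a single vertex,
-- r*(δ(A)) ≥ 1 instead, because in a 2-edge-connected graph no edge is a bridge,
-- that is, a loop of the bond matroid.

module Submission where

open import Defs
open import Data.Nat using (_+_; _<_; _≥_)
open import Data.Fin.Subset using (Subset; _⊆_; ∁; Nonempty)
open import Data.Product using (_×_; ∃-syntax)
open import Relation.Binary.PropositionalEquality using (_≡_)
open import Function.Bundles using (_⇔_)

open import Data.Bool using (Bool; true; false; _∧_; _∨_; not; if_then_else_)
open import Data.Bool.Properties using (∧-zeroʳ; ∨-zeroʳ; ∧-identityʳ; ∧-idem; T-≡) renaming (_≟_ to _≟ᵇ_)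
open import Data.Nat using (ℕ; zero; suc; _*_; _∸_; _≤_; z≤n; s≤s; _<ᵇ_; >-nonZero⁻¹)
open import Data.Nat.Properties hiding (_≟_)
open import Data.Nat.Tactic.RingSolver using (solve-∀)
open import Data.Fin using (Fin; zero; suc; toℕ; _≟_)
open import Data.Fin.Properties using (toℕ-injective; ¬∀⟶∃¬; any?; nonZeroIndex)
open import Data.Fin.Subset using (∣_∣; _∈_; ⊤; ⁅_⁆; _∪_; _-_)
open import Data.Fin.Subset.Properties
  using (p─⊥≡p; p─q⊆p; Empty-unique; ∣⊥∣≡0; x∈⁅y⁆⇒x≡y; x∈⁅x⁆; ∣⁅x⁆∣≡1; p⊂q⇒∣p∣<∣q∣; ∣p∣≤n; nonempty?; _⊆?_; anySubset?; ⊆-antisym; _∈?_)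
open import Data.Vec using (Vec; lookup; tabulate; _∷_; []; _∷ʳ_)
open import Data.Vec.Properties
  using (lookup∘tabulate; lookup-zipWith; tabulate∘lookup; tabulate-cong; []=⇒lookup; lookup⇒[]=; ≡-dec; lookup-replicate; lookup-map)
open import Data.Product using (Σ; _,_; proj₁; proj₂)
open import Data.Sum using (_⊎_; inj₁; inj₂)
open import Data.Unit using (tt) renaming (⊤ to Unit)
open import Data.Empty using (⊥; ⊥-elim)
open import Function.Bundles using (mk⇔; Equivalence)
open import Function.Base using (_∘_)
open import Algebra.Properties.CommutativeMonoid.Sum +-0-commutativeMonoid
  using (sum-cong-≗; sum-replicate-zero; ∑-distrib-+; sum-syntax)
open import Relation.Binary.PropositionalEquality
  using (_≢_; refl; sym; trans; cong; cong₂; subst; module ≡-Reasoning)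
open import Relation.Binary using (tri<; tri≈; tri>)
open import Relation.Nullary using (¬_; Dec; does; yes; no)
import Relation.Unary as U
open import Relation.Nullary.Decidable using (dec-true; dec-false; decidable-stable; _×-dec_; _→-dec_; ¬?)

∧-elimˡ : ∀ {x y} → x ∧ y ≡ true → x ≡ true
∧-elimˡ {true} _ = refl

∧-elimʳ : ∀ {x y} → x ∧ y ≡ true → y ≡ true
∧-elimʳ {true} p = p

∧-intro : ∀ {x y} → x ≡ true → y ≡ true → x ∧ y ≡ true
∧-intro refl refl = refl

∨-elim : ∀ {x y} → x ∨ y ≡ true → x ≡ true ⊎ y ≡ true
∨-elim {true}  _ = inj₁ refl
∨-elim {false} p = inj₂ p

∨-introˡ : ∀ {x y} → x ≡ true → x ∨ y ≡ true
∨-introˡ refl = refl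

∨-introʳ : ∀ {x y} → y ≡ true → x ∨ y ≡ true
∨-introʳ {true}  _ = refl
∨-introʳ {false} p = p

not≡true⇒≡false : ∀ {x} → not x ≡ true → x ≡ false
not≡true⇒≡false {false} _ = refl

true≢false : ∀ {x} → x ≡ true → x ≡ false → ⊥
true≢false refl ()

≡true-ext : ∀ {x y} → (x ≡ true → y ≡ true) → (y ≡ true → x ≡ true) → x ≡ y
≡true-ext {true}  {true}  f g = refl
≡true-ext {true}  {false} f g = sym (f refl)
≡true-ext {false} {true}  f g = g refl
≡true-ext {false} {false} f g = refl

does≡true⇒ : ∀ {a} {A : Set a} (a? : Dec A) → does a? ≡ true → A
does≡true⇒ (yes a) _ = a

≟-refl : ∀ {k} (i : Fin k) → does (i ≟ i) ≡ true
≟-refl i = dec-true (i ≟ i) refl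

<ᵇ≡true⇒< : ∀ {a b} → (a <ᵇ b) ≡ true → a < b
<ᵇ≡true⇒< {a} {b} p = <ᵇ⇒< a b (Equivalence.from T-≡ p)

<⇒<ᵇ≡true : ∀ {a b} → a < b → (a <ᵇ b) ≡ true
<⇒<ᵇ≡true p = Equivalence.to T-≡ (<⇒<ᵇ p)

∈⇒lookup : ∀ {k} {p : Subset k} {x} → x ∈ p → lookup p x ≡ true
∈⇒lookup = []=⇒lookup

lookup⇒∈ : ∀ {k} {p : Subset k} {x} → lookup p x ≡ true → x ∈ p
lookup⇒∈ {p = p} {x} = lookup⇒[]= x p

lookup-⊤ : ∀ {k} (i : Fin k) → lookup ⊤ i ≡ true
lookup-⊤ i = lookup-replicate i true

lookup-∁ : ∀ {k} (p : Subset k) i → lookup (∁ p) i ≡ not (lookup p i)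
lookup-∁ p i = lookup-map i not p

lookup-ext : ∀ {a} {A : Set a} {k} (xs ys : Vec A k) → (∀ i → lookup xs i ≡ lookup ys i) → xs ≡ ys
lookup-ext xs ys h = trans (sym (tabulate∘lookup xs)) (trans (tabulate-cong h) (tabulate∘lookup ys))

lookup-⁅⁆ : ∀ {k} (x i : Fin k) → lookup ⁅ x ⁆ i ≡ does (i ≟ x)
lookup-⁅⁆ zero    zero    = refl
lookup-⁅⁆ zero    (suc i) = lookup-replicate i false
lookup-⁅⁆ (suc x) zero    = refl
lookup-⁅⁆ (suc x) (suc i) = lookup-⁅⁆ x i

lookup-∪⁅⁆ : ∀ {k} (p : Subset k) x i → lookup (p ∪ ⁅ x ⁆) i ≡ (lookup p i ∨ does (i ≟ x))
lookup-∪⁅⁆ p x i = trans (lookup-zipWith _∨_ i p ⁅ x ⁆) (cong (lookup p i ∨_) (lookup-⁅⁆ x i))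

lookup-[p-x] : ∀ {k} (p : Subset k) x i → lookup (p - x) i ≡ (lookup p i ∧ not (does (i ≟ x)))
lookup-[p-x] (b ∷ p) zero    zero    = sym (∧-zeroʳ b)
lookup-[p-x] (b ∷ p) zero    (suc i) = trans (cong (λ q → lookup q i) (p─⊥≡p p)) (sym (∧-identityʳ _))
lookup-[p-x] (b ∷ p) (suc x) zero    = sym (∧-identityʳ b)
lookup-[p-x] (b ∷ p) (suc x) (suc i) = lookup-[p-x] p x i

anyF⇒∃ : ∀ {k} (f : Fin k → Bool) → anyF f ≡ true → ∃[ i ] f i ≡ true
anyF⇒∃ {suc k} f p with f zero in eq
... | true  = zero , eq
... | false = let (i , q) = anyF⇒∃ (λ i → f (suc i)) p in suc i , q

∃⇒anyF : ∀ {k} (f : Fin k → Bool) i → f i ≡ true → anyF f ≡ true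
∃⇒anyF {suc k} f zero    p rewrite p = refl
∃⇒anyF {suc k} f (suc i) p = ∨-introʳ (∃⇒anyF (λ i → f (suc i)) i p)

anyF-cong : ∀ {k} {f g : Fin k → Bool} → (∀ i → f i ≡ g i) → anyF f ≡ anyF g
anyF-cong {zero}  h = refl
anyF-cong {suc k} h = cong₂ _∨_ (h zero) (anyF-cong (λ i → h (suc i)))

countF-cong : ∀ {k} {f g : Fin k → Bool} → (∀ i → f i ≡ g i) → countF f ≡ countF g
countF-cong {zero}  h = refl
countF-cong {suc k} h = cong₂ _+_ (cong (λ b → if b then 1 else 0) (h zero)) (countF-cong (λ i → h (suc i)))

countF-∨-∧ : ∀ {k} (f g : Fin k → Bool) →
  countF (λ i → f i ∨ g i) + countF (λ i → f i ∧ g i) ≡ countF f + countF g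
countF-∨-∧ {zero}  f g = refl
countF-∨-∧ {suc k} f g with f zero | g zero | countF-∨-∧ (λ i → f (suc i)) (λ i → g (suc i))
... | true  | true  | ih = cong suc (trans (+-suc _ _) (trans (cong suc ih) (sym (+-suc _ _))))
... | true  | false | ih = cong suc ih
... | false | true  | ih = trans (cong suc ih) (sym (+-suc _ _))
... | false | false | ih = ih

countF-mono : ∀ {k} (f g : Fin k → Bool) → (∀ i → f i ≡ true → g i ≡ true) → countF f ≤ countF g
countF-mono {zero}  f g h = z≤n
countF-mono {suc k} f g h with f zero in ef | g zero in eg
... | true  | true  = s≤s (countF-mono _ _ (λ i → h (suc i)))
... | true  | false = ⊥-elim (true≢false (h zero ef) eg)
... | false | true  = m≤n⇒m≤1+n (countF-mono _ _ (λ i → h (suc i)))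
... | false | false = countF-mono _ _ (λ i → h (suc i))

countF≤k : ∀ {k} (f : Fin k → Bool) → countF f ≤ k
countF≤k {zero}  f = z≤n
countF≤k {suc k} f with f zero
... | true  = s≤s (countF≤k _)
... | false = m≤n⇒m≤1+n (countF≤k (λ i → f (suc i)))

countF-false : ∀ {k} (f : Fin k → Bool) → (∀ i → f i ≡ false) → countF f ≡ 0
countF-false {zero}  f h = refl
countF-false {suc k} f h rewrite h zero = countF-false _ (λ i → h (suc i))

countF>0⇒∃ : ∀ {k} (f : Fin k → Bool) → 0 < countF f → ∃[ i ] f i ≡ true
countF>0⇒∃ {suc k} f p with f zero in eq
... | true  = zero , eq
... | false = let (i , q) = countF>0⇒∃ (λ i → f (suc i)) p in suc i , q

countF-≟ : ∀ {k} (a : Fin k) → countF (λ i → does (i ≟ a)) ≡ 1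
countF-≟ {suc k} zero    = cong suc (countF-false {k} _ (λ i → refl))
countF-≟ {suc k} (suc a) = countF-≟ a

countF≡0⇒false : ∀ {k} (f : Fin k → Bool) → countF f ≡ 0 → ∀ i → f i ≡ false
countF≡0⇒false {suc k} f eq i with f zero in f0
countF≡0⇒false {suc k} f ()  i       | true
countF≡0⇒false {suc k} f eq  zero    | false = f0
countF≡0⇒false {suc k} f eq  (suc i) | false = countF≡0⇒false (f ∘ suc) eq i

countF-∨-disjoint : ∀ {k} (f g : Fin k → Bool) → (∀ i → (f i ∧ g i) ≡ false) →
  countF (λ i → f i ∨ g i) ≡ countF f + countF g
countF-∨-disjoint f g disj =
  trans (sym (+-identityʳ _)) (trans (cong (countF (λ i → f i ∨ g i) +_) (sym (countF-false _ disj))) (countF-∨-∧ f g))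

countF-insert : ∀ {k} (f : Fin k → Bool) e → f e ≡ false → countF (λ x → f x ∨ does (x ≟ e)) ≡ suc (countF f)
countF-insert f e fe = begin
    countF (λ x → f x ∨ does (x ≟ e))        ≡⟨ countF-∨-disjoint f _ disj ⟩
    countF f + countF (λ x → does (x ≟ e))   ≡⟨ cong (countF f +_) (countF-≟ e) ⟩
    countF f + 1                             ≡⟨ +-comm _ 1 ⟩
    suc (countF f)                           ∎
  where
  open ≡-Reasoning
  disj : ∀ x → (f x ∧ does (x ≟ e)) ≡ false
  disj x with x ≟ e
  ... | yes refl = cong (_∧ true) fe
  ... | no _     = ∧-zeroʳ _

countF-delete : ∀ {k} (f : Fin k → Bool) e → f e ≡ true → countF f ≡ suc (countF (λ x → f x ∧ not (does (x ≟ e))))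
countF-delete f e fe = trans (countF-cong reassemble) (countF-insert _ e e∉)
  where
  e∉ : (f e ∧ not (does (e ≟ e))) ≡ false
  e∉ rewrite ≟-refl e = ∧-zeroʳ (f e)
  reassemble : ∀ x → f x ≡ ((f x ∧ not (does (x ≟ e))) ∨ does (x ≟ e))
  reassemble x with x ≟ e
  ... | yes refl = trans fe (sym (∨-zeroʳ _))
  ... | no _ with f x
  ...   | true  = refl
  ...   | false = refl

∣p∣≡countF : ∀ {k} (p : Subset k) → ∣ p ∣ ≡ countF (lookup p)
∣p∣≡countF []          = refl
∣p∣≡countF (true ∷ p)  = cong suc (∣p∣≡countF p)
∣p∣≡countF (false ∷ p) = ∣p∣≡countF p

∣p∣≡suc∣p-x∣ : ∀ {k} (p : Subset k) x → lookup p x ≡ true → ∣ p ∣ ≡ suc ∣ p - x ∣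
∣p∣≡suc∣p-x∣ p x x∈p = begin
  ∣ p ∣                                            ≡⟨ ∣p∣≡countF p ⟩
  countF (lookup p)                                ≡⟨ countF-delete (lookup p) x x∈p ⟩
  suc (countF (λ i → lookup p i ∧ not (does (i ≟ x)))) ≡⟨ cong suc (countF-cong (λ i → sym (lookup-[p-x] p x i))) ⟩
  suc (countF (lookup (p - x)))                    ≡⟨ cong suc (sym (∣p∣≡countF (p - x))) ⟩
  suc ∣ p - x ∣                                    ∎
  where open ≡-Reasoning

∣p∪⁅x⁆∣≡suc∣p∣ : ∀ {k} (p : Subset k) x → lookup p x ≡ false → ∣ p ∪ ⁅ x ⁆ ∣ ≡ suc ∣ p ∣
∣p∪⁅x⁆∣≡suc∣p∣ p x x∉p = begin
  ∣ p ∪ ⁅ x ⁆ ∣                           ≡⟨ ∣p∣≡countF (p ∪ ⁅ x ⁆) ⟩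
  countF (lookup (p ∪ ⁅ x ⁆))             ≡⟨ countF-cong (lookup-∪⁅⁆ p x) ⟩
  countF (λ i → lookup p i ∨ does (i ≟ x)) ≡⟨ countF-insert (lookup p) x x∉p ⟩
  suc (countF (lookup p))                 ≡⟨ cong suc (sym (∣p∣≡countF p)) ⟩
  suc ∣ p ∣                                ∎
  where open ≡-Reasoning

∁[p∪⁅x⁆]≡∁p-x : ∀ {k} (p : Subset k) x → ∁ (p ∪ ⁅ x ⁆) ≡ ∁ p - x
∁[p∪⁅x⁆]≡∁p-x p x = lookup-ext _ _ λ i → begin
  lookup (∁ (p ∪ ⁅ x ⁆)) i                ≡⟨ lookup-∁ (p ∪ ⁅ x ⁆) i ⟩
  not (lookup (p ∪ ⁅ x ⁆) i)              ≡⟨ cong not (lookup-∪⁅⁆ p x i) ⟩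
  not (lookup p i ∨ does (i ≟ x))         ≡⟨ not-∨ (lookup p i) (does (i ≟ x)) ⟩
  not (lookup p i) ∧ not (does (i ≟ x))   ≡⟨ cong (_∧ _) (sym (lookup-∁ p i)) ⟩
  lookup (∁ p) i ∧ not (does (i ≟ x))     ≡⟨ sym (lookup-[p-x] (∁ p) x i) ⟩
  lookup (∁ p - x) i                      ∎
  where
  open ≡-Reasoning
  not-∨ : ∀ a b → not (a ∨ b) ≡ (not a ∧ not b)
  not-∨ true  b = refl
  not-∨ false b = refl

lookup-[p-x]-x : ∀ {k} (p : Subset k) x → lookup (p - x) x ≡ false
lookup-[p-x]-x p x rewrite lookup-[p-x] p x x | ≟-refl x = ∧-zeroʳ (lookup p x)

when : Bool → ℕ → ℕ
when b x = if b then x else 0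

when-+ : ∀ b x y → when b (x + y) ≡ when b x + when b y
when-+ true  x y = refl
when-+ false x y = refl

when-0 : ∀ b → when b 0 ≡ 0
when-0 true  = refl
when-0 false = refl

∑-zero : ∀ {k} (f : Fin k → ℕ) → (∀ i → f i ≡ 0) → ∑[ i < k ] f i ≡ 0
∑-zero {k} f h = trans (sum-cong-≗ h) (sum-replicate-zero k)

∑-when-≟ : ∀ {k} (B : Fin k → Bool) (c : Fin k) → ∑[ v < k ] when (B v) (when (does (c ≟ v)) 1) ≡ when (B c) 1
∑-when-≟ {suc k} B zero =
  trans (cong (when (B zero) 1 +_) (∑-zero _ λ v → when-0 (B (suc v)))) (+-identityʳ _)
∑-when-≟ {suc k} B (suc c) =
  trans (cong (_+ ∑[ v < k ] when (B (suc v)) (when (does (c ≟ v)) 1)) (when-0 (B zero))) (∑-when-≟ (B ∘ suc) c)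

countF∘≡∑-fibres : ∀ {k m} (f : Fin m → Fin k) (B : Fin k → Bool) →
  countF (λ e → B (f e)) ≡ ∑[ v < k ] when (B v) (countF (λ e → does (f e ≟ v)))
countF∘≡∑-fibres {k} {zero} f B = sym (∑-zero _ λ v → when-0 (B v))
countF∘≡∑-fibres {k} {suc m} f B = begin
    when (B (f zero)) 1 + countF (λ e → B (f (suc e)))
  ≡⟨ cong₂ _+_ (sym (∑-when-≟ B (f zero))) (countF∘≡∑-fibres (f ∘ suc) B) ⟩
    ∑[ v < k ] when (B v) (when (does (f zero ≟ v)) 1) + ∑[ v < k ] when (B v) (countF (λ e → does (f (suc e) ≟ v)))
  ≡⟨ sym (∑-distrib-+ (λ v → when (B v) (when (does (f zero ≟ v)) 1))
                       (λ v → when (B v) (countF (λ e → does (f (suc e) ≟ v))))) ⟩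
    ∑[ v < k ] (when (B v) (when (does (f zero ≟ v)) 1) + when (B v) (countF (λ e → does (f (suc e) ≟ v))))
  ≡⟨ sum-cong-≗ (λ v → sym (when-+ (B v) _ _)) ⟩
    ∑[ v < k ] when (B v) (countF (λ e → does (f e ≟ v)))
  ∎
  where open ≡-Reasoning

∑-when-const : ∀ {k} (B : Fin k → Bool) (d : Fin k → ℕ) c → (∀ v → d v ≡ c) →
  ∑[ v < k ] when (B v) (d v) ≡ c * countF B
∑-when-const {zero}  B d c h = sym (*-zeroʳ c)
∑-when-const {suc k} B d c h rewrite ∑-when-const (B ∘ suc) (d ∘ suc) c (h ∘ suc) | h zero with B zero
... | true  = sym (*-suc c _)
... | false = refl

[2a+w+[n∸[a+v]]]∸[n∸1]≡[1+a+w]∸v : ∀ a w v n → 1 ≤ n → a + v ≤ n →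
  (a + a + w + (n ∸ (a + v))) ∸ (n ∸ 1) ≡ suc (a + w) ∸ v
[2a+w+[n∸[a+v]]]∸[n∸1]≡[1+a+w]∸v a w v (suc n) _ a+v≤1+n = begin
    suc (a + a + w + t) ∸ suc n         ≡⟨ cong₂ _∸_ (shuffle₁ a w t) (trans (sym (m+[n∸m]≡n a+v≤1+n)) (shuffle₂ a v t)) ⟩
    (a + t + suc (a + w)) ∸ (a + t + v) ≡⟨ [m+n]∸[m+o]≡n∸o (a + t) (suc (a + w)) v ⟩
    suc (a + w) ∸ v                     ∎
  where
  open ≡-Reasoning
  t = suc n ∸ (a + v)
  shuffle₁ : ∀ a w t → suc (a + a + w + t) ≡ a + t + suc (a + w)
  shuffle₁ = solve-∀
  shuffle₂ : ∀ a v t → a + v + t ≡ a + t + v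
  shuffle₂ = solve-∀

[1+m+n]∸o≤m⇔n<o : ∀ m n o → suc (m + n) ∸ o ≤ m ⇔ n < o
[1+m+n]∸o≤m⇔n<o m n o = mk⇔
  (λ le → +-cancelˡ-≤ m (suc n) o (begin
    m + suc n                ≡⟨ +-suc m n ⟩
    suc (m + n)              ≤⟨ m≤n+m∸n (suc (m + n)) o ⟩
    o + (suc (m + n) ∸ o)    ≤⟨ +-monoʳ-≤ o le ⟩
    o + m                    ≡⟨ +-comm o m ⟩
    m + o                    ∎))
  (λ lt → m≤n+o⇒m∸n≤o (suc (m + n)) o (begin
    suc (m + n)              ≡⟨ sym (+-suc m n) ⟩
    m + suc n                ≤⟨ +-monoʳ-≤ m lt ⟩
    m + o                    ≡⟨ +-comm m o ⟩
    o + m                    ∎))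
  where open ≤-Reasoning

Minimal : ∀ {k} → (Subset k → Set) → Subset k → Set
Minimal P C = Nonempty C × P C × (∀ D → Nonempty D → D ⊆ C → P D → D ≡ C)

minimal-⊆ : ∀ {k} {P : Subset k → Set} → U.Decidable P → ∀ B → Nonempty B → P B → ∃[ C ] (C ⊆ B × Minimal P C)
minimal-⊆ {k} {P} P? B = go (suc ∣ B ∣) B ≤-refl
  where
  go : ∀ fuel B → ∣ B ∣ < fuel → Nonempty B → P B → ∃[ C ] (C ⊆ B × Minimal P C)
  go (suc fuel) B ∣B∣<fuel B≠∅ PB
    with anySubset? {P = λ D → Nonempty D × D ⊆ B × P D × D ≢ B}
           (λ D → nonempty? D ×-dec (D ⊆? B) ×-dec P? D ×-dec ¬? (≡-dec _≟ᵇ_ D B))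
  ... | yes (D , D≠∅ , D⊆B , PD , D≢B) =
    let (C , C⊆D , minimal) = go fuel D (≤-trans (p⊂q⇒∣p∣<∣q∣ (D⊆B , x , x∈B , x∉D)) (≤-pred ∣B∣<fuel)) D≠∅ PD
    in C , (λ x∈C → D⊆B (C⊆D x∈C)) , minimal
    where
    outside-D = ¬∀⟶∃¬ k (λ x → x ∈ B → x ∈ D) (λ x → (x ∈? B) →-dec (x ∈? D))
                  (λ B⊆D → D≢B (⊆-antisym D⊆B (λ {x} → B⊆D x)))
    x = proj₁ outside-D
    x∈B : x ∈ B
    x∈B = decidable-stable (x ∈? B) λ x∉B → proj₂ outside-D λ x∈B → ⊥-elim (x∉B x∈B)
    x∉D : ¬ (x ∈ D)
    x∉D x∈D = proj₂ outside-D (λ _ → x∈D)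
  ... | no no-smaller = B , (λ x∈B → x∈B) , B≠∅ , PB , λ D D≠∅ D⊆B PD → equal D D≠∅ D⊆B PD
    where
    equal : ∀ D → Nonempty D → D ⊆ B → P D → D ≡ B
    equal D D≠∅ D⊆B PD with ≡-dec _≟ᵇ_ D B
    ... | yes D≡B = D≡B
    ... | no D≢B  = ⊥-elim (no-smaller (D , D≠∅ , D⊆B , PD , D≢B))

-- Classes of an equivalence relation, counted by their least elements;
-- `components G S F` is `classes (lookup S) (connected G S F)`.

module Classes {k : ℕ} (s : Fin k → Bool) where

  isLeast : (Fin k → Fin k → Bool) → Fin k → Bool
  isLeast C v = s v ∧ not (anyF λ w → (toℕ w <ᵇ toℕ v) ∧ s w ∧ C w v)

  classes : (Fin k → Fin k → Bool) → ℕ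
  classes C = countF (isLeast C)

  classes-cong : ∀ {C C'} → (∀ x y → C x y ≡ C' x y) → classes C ≡ classes C'
  classes-cong h = countF-cong λ v → cong (λ b → s v ∧ not b)
    (anyF-cong λ w → cong (λ b → (toℕ w <ᵇ toℕ v) ∧ s w ∧ b) (h w v))

  classes≤ : ∀ C → classes C ≤ countF s
  classes≤ C = countF-mono (isLeast C) s λ i p → ∧-elimˡ {s i} p

  isLeast⇒s : ∀ C v → isLeast C v ≡ true → s v ≡ true
  isLeast⇒s C v p = ∧-elimˡ {s v} p

  isLeast-minimal : ∀ C v w → isLeast C v ≡ true → toℕ w < toℕ v → s w ≡ true → C w v ≡ true → ⊥
  isLeast-minimal C v w p lt sw cw =
    true≢false (∃⇒anyF (λ w → (toℕ w <ᵇ toℕ v) ∧ s w ∧ C w v) w (∧-intro (<⇒<ᵇ≡true lt) (∧-intro sw cw)))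
               (not≡true⇒≡false (∧-elimʳ {s v} p))

  ¬isLeast⇒smaller : ∀ C v → isLeast C v ≡ false → s v ≡ true →
    ∃[ w ] (toℕ w < toℕ v × s w ≡ true × C w v ≡ true)
  ¬isLeast⇒smaller C v p sv with anyF (λ w → (toℕ w <ᵇ toℕ v) ∧ s w ∧ C w v) in eq
  ... | true  = let (w , q) = anyF⇒∃ _ eq in
    w , <ᵇ≡true⇒< (∧-elimˡ {toℕ w <ᵇ toℕ v} q) , ∧-elimˡ {s w} (∧-elimʳ {toℕ w <ᵇ toℕ v} q) ,
    ∧-elimʳ {s w} (∧-elimʳ {toℕ w <ᵇ toℕ v} q)
  ... | false rewrite sv = ⊥-elim (true≢false refl p)

  isLeast-intro : ∀ C v → s v ≡ true → (∀ w → toℕ w < toℕ v → s w ≡ true → C w v ≡ true → ⊥) →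
    isLeast C v ≡ true
  isLeast-intro C v sv h with isLeast C v in eq
  ... | true  = refl
  ... | false = let (w , lt , sw , cw) = ¬isLeast⇒smaller C v eq sv in ⊥-elim (h w lt sw cw)

  module _ (C : Fin k → Fin k → Bool)
           (C-refl : ∀ x → C x x ≡ true)
           (C-sym : ∀ x y → C x y ≡ true → C y x ≡ true)
           (C-trans : ∀ x y z → C x y ≡ true → C y z ≡ true → C x z ≡ true) where

    isLeast-unique : ∀ v v' → isLeast C v ≡ true → isLeast C v' ≡ true → C v v' ≡ true → v ≡ v'
    isLeast-unique v v' p p' c with <-cmp (toℕ v) (toℕ v')
    ... | tri< lt _ _ = ⊥-elim (isLeast-minimal C v' v p' lt (isLeast⇒s C v p) c)
    ... | tri≈ _ eq _ = toℕ-injective eq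
    ... | tri> _ _ gt = ⊥-elim (isLeast-minimal C v v' p gt (isLeast⇒s C v' p') (C-sym _ _ c))

    least-exists : ∀ a → s a ≡ true → ∃[ r ] (isLeast C r ≡ true × C r a ≡ true)
    least-exists a = go (suc (toℕ a)) a ≤-refl
      where
      go : ∀ fuel a → toℕ a < fuel → s a ≡ true → ∃[ r ] (isLeast C r ≡ true × C r a ≡ true)
      go (suc fuel) a lt sa with isLeast C a in eq
      ... | true  = a , eq , C-refl a
      ... | false = let (w , lw , sw , cw) = ¬isLeast⇒smaller C a eq sa
                        (r , pr , cr) = go fuel w (≤-trans lw (≤-pred lt)) sw
                    in r , pr , C-trans _ _ _ cr cw

    JoinsClassesOf : (C' : Fin k → Fin k → Bool) (a b : Fin k) → Set
    JoinsClassesOf C' a b =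
      (∀ x y → C x y ≡ true → C' x y ≡ true) ×
      (∀ x y → C x a ≡ true → C b y ≡ true → C' x y ≡ true) ×
      (∀ x y → C x b ≡ true → C a y ≡ true → C' x y ≡ true) ×
      (∀ x y → C' x y ≡ true →
        C x y ≡ true ⊎ ((C x a ≡ true × C b y ≡ true) ⊎ (C x b ≡ true × C a y ≡ true)))

    private
      joins-swap : ∀ {C' a b} → JoinsClassesOf C' a b → JoinsClassesOf C' b a
      joins-swap (h⊆ , hab , hba , helim) = h⊆ , hba , hab , λ x y c → swap (helim x y c)
        where
        swap : ∀ {P Q R : Set} → P ⊎ (Q ⊎ R) → P ⊎ (R ⊎ Q)
        swap (inj₁ p)        = inj₁ p
        swap (inj₂ (inj₁ q)) = inj₂ (inj₂ q)
        swap (inj₂ (inj₂ r)) = inj₂ (inj₁ r)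

      -- the class of b loses its least element rb to the smaller ra
      merge-ordered : ∀ {C' a b} → JoinsClassesOf C' a b → ∀ ra rb →
        isLeast C ra ≡ true → isLeast C rb ≡ true → C ra a ≡ true → C rb b ≡ true → toℕ ra < toℕ rb →
        classes C ≡ suc (classes C')
      merge-ordered {C'} {a} {b} (h⊆ , hab , hba , helim) ra rb pra prb cra crb lt =
        trans (countF-cong pointwise) (countF-insert (isLeast C') rb rb-lost)
        where
        kept : ∀ v → isLeast C' v ≡ true → isLeast C v ≡ true
        kept v p = isLeast-intro C v (isLeast⇒s C' v p) λ w lw sw cw → isLeast-minimal C' v w p lw sw (h⊆ w v cw)

        rb-lost : isLeast C' rb ≡ false
        rb-lost with isLeast C' rb in eq
        ... | false = refl
        ... | true  = ⊥-elim (isLeast-minimal C' rb ra eq lt (isLeast⇒s C ra pra) (hab ra rb cra (C-sym _ _ crb)))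

        survives : ∀ v → isLeast C v ≡ true → v ≢ rb → isLeast C' v ≡ true
        survives v p ne = isLeast-intro C' v (isLeast⇒s C v p) λ w lw sw cw → excluded (helim w v cw) lw sw
          where
          excluded : ∀ {w} → C w v ≡ true ⊎ ((C w a ≡ true × C b v ≡ true) ⊎ (C w b ≡ true × C a v ≡ true)) →
            toℕ w < toℕ v → s w ≡ true → ⊥
          excluded (inj₁ c) lw sw = isLeast-minimal C v _ p lw sw c
          excluded (inj₂ (inj₁ (_ , bv))) lw sw = ne (sym (isLeast-unique rb v prb p (C-trans _ _ _ crb bv)))
          excluded {w} (inj₂ (inj₂ (wb , av))) lw sw with isLeast-unique ra v pra p (C-trans _ _ _ cra av)
          ... | refl = isLeast-minimal C rb w prb (<-trans lw lt) sw (C-trans _ _ _ wb (C-sym _ _ crb))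

        pointwise : ∀ v → isLeast C v ≡ (isLeast C' v ∨ does (v ≟ rb))
        pointwise v = ≡true-ext to from
          where
          to : isLeast C v ≡ true → (isLeast C' v ∨ does (v ≟ rb)) ≡ true
          to p with v ≟ rb
          ... | yes _ = ∨-zeroʳ (isLeast C' v)
          ... | no ne = ∨-introˡ (survives v p ne)
          from : (isLeast C' v ∨ does (v ≟ rb)) ≡ true → isLeast C v ≡ true
          from q with ∨-elim q
          ... | inj₁ r = kept v r
          ... | inj₂ r with does≡true⇒ (v ≟ rb) r
          ...   | refl = prb

    classes-merge : ∀ {C' a b} → JoinsClassesOf C' a b → s a ≡ true → s b ≡ true → C a b ≡ false →
      classes C ≡ suc (classes C')
    classes-merge J sa sb cab with least-exists _ sa | least-exists _ sb
    ... | ra , pra , cra | rb , prb , crb with <-cmp (toℕ ra) (toℕ rb)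
    ... | tri< lt _ _ = merge-ordered J ra rb pra prb cra crb lt
    ... | tri> _ _ gt = merge-ordered (joins-swap J) rb ra prb pra crb cra gt
    ... | tri≈ _ eq _ with toℕ-injective eq
    ...   | refl = ⊥-elim (true≢false (C-trans _ _ _ (C-sym _ _ cra) crb) cab)

module _ (G : Graph) where
  open Graph G

  Adjacent : Subset n → Subset m → Fin n → Fin n → Set
  Adjacent S F x y = ∃[ e ] (usable G S F e ≡ true × joins G e x y)

  joins-sym : ∀ {e x y} → joins G e x y → joins G e y x
  joins-sym (inj₁ (s , t)) = inj₂ (s , t)
  joins-sym (inj₂ (s , t)) = inj₁ (s , t)

  data Walk (S : Subset n) (F : Subset m) : Fin n → Fin n → Set where
    [] : ∀ {x} → Walk S F x x
    _∷_ : ∀ {x y z} → Adjacent S F x y → Walk S F y z → Walk S F x z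

  module _ {S : Subset n} {F : Subset m} where

    walk-snoc : ∀ {x y z} → Walk S F x y → Adjacent S F y z → Walk S F x z
    walk-snoc []      a = a ∷ []
    walk-snoc (b ∷ w) a = b ∷ walk-snoc w a

    walk-++ : ∀ {x y z} → Walk S F x y → Walk S F y z → Walk S F x z
    walk-++ []      w' = w'
    walk-++ (a ∷ w) w' = a ∷ walk-++ w w'

    walk-reverse : ∀ {x y} → Walk S F x y → Walk S F y x
    walk-reverse []                  = []
    walk-reverse ((e , u , j) ∷ w) = walk-snoc (walk-reverse w) (e , u , joins-sym j)

  walk-map : ∀ {S F S' F'} → (∀ e → usable G S F e ≡ true → usable G S' F' e ≡ true) →
    ∀ {x y} → Walk S F x y → Walk S' F' x y
  walk-map h []                = []
  walk-map h ((d , u , j) ∷ w) = (d , h d u , j) ∷ walk-map h w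

  module _ (S : Subset n) (F : Subset m) where

    private
      reached : ℕ → Fin n → Subset n
      reached k u = iter k (step G S F) ⁅ u ⁆

      lookup-step : ∀ Q v → lookup (step G S F Q) v ≡ (lookup Q v ∨ anyF (λ e → usable G S F e ∧
                      ((lookup Q (src e) ∧ does (tgt e ≟ v)) ∨ (lookup Q (tgt e) ∧ does (src e ≟ v)))))
      lookup-step Q v = lookup∘tabulate _ v

      step-⊇ : ∀ Q v → lookup Q v ≡ true → lookup (step G S F Q) v ≡ true
      step-⊇ Q v p rewrite lookup-step Q v = ∨-introˡ p

      step-adjacent : ∀ Q y z → lookup Q y ≡ true → Adjacent S F y z → lookup (step G S F Q) z ≡ true
      step-adjacent Q y z p (e , u , inj₁ (refl , refl)) rewrite lookup-step Q z =
        ∨-introʳ (∃⇒anyF _ e (∧-intro u (∨-introˡ (∧-intro p (≟-refl z)))))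
      step-adjacent Q y z p (e , u , inj₂ (refl , refl)) rewrite lookup-step Q z =
        ∨-introʳ (∃⇒anyF _ e (∧-intro u (∨-introʳ (∧-intro p (≟-refl z)))))

      reached⇒Walk : ∀ k u v → lookup (reached k u) v ≡ true → Walk S F u v
      reached⇒Walk zero u v p with x∈⁅y⁆⇒x≡y u (lookup⇒∈ p)
      ... | refl = []
      reached⇒Walk (suc k) u v p rewrite lookup-step (reached k u) v with ∨-elim p
      ... | inj₁ q = reached⇒Walk k u v q
      ... | inj₂ q with anyF⇒∃ _ q
      ... | e , r with ∨-elim (∧-elimʳ r)
      ... | inj₁ r₁ = walk-snoc (reached⇒Walk k u (src e) (∧-elimˡ r₁))
                                (e , ∧-elimˡ r , inj₁ (refl , does≡true⇒ (tgt e ≟ v) (∧-elimʳ r₁)))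
      ... | inj₂ r₂ = walk-snoc (reached⇒Walk k u (tgt e) (∧-elimˡ r₂))
                                (e , ∧-elimˡ r , inj₂ (does≡true⇒ (src e ≟ v) (∧-elimʳ r₂) , refl))

      step-⊂ : ∀ Q → step G S F Q ≢ Q → ∣ Q ∣ < ∣ step G S F Q ∣
      step-⊂ Q ne = p⊂q⇒∣p∣<∣q∣ (Q⊆ , x , lookup⇒∈ x∈ , λ x∈Q → true≢false (∈⇒lookup x∈Q) x∉)
        where
        Q⊆ : Q ⊆ step G S F Q
        Q⊆ {x} x∈ = lookup⇒∈ (step-⊇ Q x (∈⇒lookup x∈))
        differs = ¬∀⟶∃¬ n (λ i → lookup (step G S F Q) i ≡ lookup Q i) (λ i → _≟ᵇ_ _ _)
                    (λ h → ne (lookup-ext _ _ h))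
        x = proj₁ differs
        x∉ : lookup Q x ≡ false
        x∉ with lookup Q x in eq
        ... | true  = ⊥-elim (proj₂ differs (trans (step-⊇ Q x eq) (sym eq)))
        ... | false = refl
        x∈ : lookup (step G S F Q) x ≡ true
        x∈ with lookup (step G S F Q) x in eq
        ... | true  = refl
        ... | false = ⊥-elim (proj₂ differs (trans eq (sym x∉)))

      -- a set of vertices cannot grow n times, so n steps reach the fixed point
      grows-or-stable : ∀ k u → (suc k ≤ ∣ reached k u ∣) ⊎ (step G S F (reached k u) ≡ reached k u)
      grows-or-stable zero u = inj₁ (≤-reflexive (sym (∣⁅x⁆∣≡1 u)))
      grows-or-stable (suc k) u with grows-or-stable k u
      ... | inj₂ eq = inj₂ (cong (step G S F) eq)
      ... | inj₁ le with ≡-dec _≟ᵇ_ (step G S F (reached k u)) (reached k u)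
      ...   | yes eq = inj₂ (cong (step G S F) eq)
      ...   | no ne  = inj₁ (≤-trans (s≤s le) (step-⊂ (reached k u) ne))

      reach-stable : ∀ u → step G S F (reach G S F u) ≡ reach G S F u
      reach-stable u with grows-or-stable n u
      ... | inj₁ le = ⊥-elim (<⇒≱ le (∣p∣≤n (reached n u)))
      ... | inj₂ eq = eq

      reached-start : ∀ k u → lookup (reached k u) u ≡ true
      reached-start zero    u = ∈⇒lookup (x∈⁅x⁆ u)
      reached-start (suc k) u = step-⊇ (reached k u) u (reached-start k u)

      reach-closed : ∀ u w v → lookup (reach G S F u) w ≡ true → Walk S F w v → lookup (reach G S F u) v ≡ true
      reach-closed u w v p [] = p
      reach-closed u w v p (_∷_ {y = y} a wk) =
        reach-closed u y v (subst (λ Q → lookup Q y ≡ true) (reach-stable u) (step-adjacent (reach G S F u) w y p a)) wk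

    connected⇒Walk : ∀ u v → connected G S F u v ≡ true → Walk S F u v
    connected⇒Walk u v = reached⇒Walk n u v

    Walk⇒connected : ∀ u v → Walk S F u v → connected G S F u v ≡ true
    Walk⇒connected u v w = reach-closed u u v (reached-start n u) w

  module _ {S : Subset n} {F : Subset m} where

    connected-refl : ∀ x → connected G S F x x ≡ true
    connected-refl x = Walk⇒connected S F x x []

    connected-sym : ∀ x y → connected G S F x y ≡ true → connected G S F y x ≡ true
    connected-sym x y p = Walk⇒connected S F y x (walk-reverse (connected⇒Walk S F x y p))

    connected-trans : ∀ x y z → connected G S F x y ≡ true → connected G S F y z ≡ true → connected G S F x z ≡ true
    connected-trans x y z p q =
      Walk⇒connected S F x z (walk-++ (connected⇒Walk S F x y p) (connected⇒Walk S F y z q))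

  connected-cong : ∀ S F S' F' → (∀ e → usable G S F e ≡ usable G S' F' e) → ∀ x y →
    connected G S F x y ≡ connected G S' F' x y
  connected-cong S F S' F' h x y = ≡true-ext
    (λ p → Walk⇒connected S' F' x y (walk-map (λ e u → trans (sym (h e)) u) (connected⇒Walk S F x y p)))
    (λ p → Walk⇒connected S F x y (walk-map (λ e u → trans (h e) u) (connected⇒Walk S' F' x y p)))

  components-cong : ∀ S F S' F' → (∀ e → usable G S F e ≡ usable G S' F' e) → (∀ v → lookup S v ≡ lookup S' v) →
    components G S F ≡ components G S' F'
  components-cong S F S' F' h hs = countF-cong λ v → cong₂ (λ b c → b ∧ not c) (hs v)
    (anyF-cong λ w → cong₂ (λ b c → (toℕ w <ᵇ toℕ v) ∧ b ∧ c) (hs w) (connected-cong S F S' F' h w v))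

  components≤n : ∀ S F → components G S F ≤ n
  components≤n S F = ≤-trans (Classes.classes≤ (lookup S) (connected G S F)) (countF≤k _)

  module DeleteEdge (S : Subset n) (F : Subset m) (e : Fin m) (e-usable : usable G S F e ≡ true) where

    private
      a = src e
      b = tgt e
      W⁻ = Walk S (F - e)
      W = Walk S F

      usable-delete⇒ : ∀ d → usable G S (F - e) d ≡ true → usable G S F d ≡ true
      usable-delete⇒ d p rewrite lookup-[p-x] F e d =
        ∧-intro (∧-elimˡ {lookup F d} (∧-elimˡ {lookup F d ∧ not (does (d ≟ e))} p)) (∧-elimʳ {lookup F d ∧ not (does (d ≟ e))} p)

      usable⇒usable-delete : ∀ d → usable G S F d ≡ true → d ≢ e → usable G S (F - e) d ≡ true
      usable⇒usable-delete d p ne rewrite lookup-[p-x] F e d | dec-false (d ≟ e) ne =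
        ∧-intro (∧-intro (∧-elimˡ {lookup F d} p) refl) (∧-elimʳ {lookup F d} p)

      WalkVia : Fin n → Fin n → Set
      WalkVia x y = W⁻ x y ⊎ ((W⁻ x a × W⁻ b y) ⊎ (W⁻ x b × W⁻ a y))

      prepend : ∀ {x x' y} → W⁻ x x' → WalkVia x' y → WalkVia x y
      prepend p (inj₁ q)             = inj₁ (walk-++ p q)
      prepend p (inj₂ (inj₁ (q , r))) = inj₂ (inj₁ (walk-++ p q , r))
      prepend p (inj₂ (inj₂ (q , r))) = inj₂ (inj₂ (walk-++ p q , r))

      crossFromA : ∀ {y} → WalkVia b y → WalkVia a y
      crossFromA (inj₁ q)             = inj₂ (inj₁ ([] , q))
      crossFromA (inj₂ (inj₁ (q , r))) = inj₁ (walk-++ (walk-reverse q) r)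
      crossFromA (inj₂ (inj₂ (q , r))) = inj₁ r

      crossFromB : ∀ {y} → WalkVia a y → WalkVia b y
      crossFromB (inj₁ q)             = inj₂ (inj₂ ([] , q))
      crossFromB (inj₂ (inj₁ (q , r))) = inj₁ r
      crossFromB (inj₂ (inj₂ (q , r))) = inj₁ (walk-++ (walk-reverse q) r)

      split : ∀ {x y} → W x y → WalkVia x y
      split [] = inj₁ []
      split ((d , u , j) ∷ w) with d ≟ e
      ... | no ne = prepend ((d , usable⇒usable-delete d u ne , j) ∷ []) (split w)
      split ((d , u , inj₁ (refl , refl)) ∷ w) | yes refl = crossFromA (split w)
      split ((d , u , inj₂ (refl , refl)) ∷ w) | yes refl = crossFromB (split w)

      undelete : ∀ {x y} → W⁻ x y → W x y
      undelete = walk-map usable-delete⇒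

      C⁻ = connected G S (F - e)
      C = connected G S F

      C⁻⇒C : ∀ x y → C⁻ x y ≡ true → C x y ≡ true
      C⁻⇒C x y p = Walk⇒connected S F x y (undelete (connected⇒Walk S (F - e) x y p))

      a∈S : lookup S a ≡ true
      a∈S = ∧-elimˡ {lookup S a} (∧-elimʳ {lookup F e} e-usable)

      b∈S : lookup S b ≡ true
      b∈S = ∧-elimʳ {lookup S a} (∧-elimʳ {lookup F e} e-usable)

    components-delete-bridge : C⁻ a b ≡ false → components G S (F - e) ≡ suc (components G S F)
    components-delete-bridge a≁b = Classes.classes-merge (lookup S) C⁻
      (connected-refl {S} {F - e}) (connected-sym {S} {F - e}) (connected-trans {S} {F - e})
      (C⁻⇒C , via-ab , via-ba , uses-e) a∈S b∈S a≁b
      where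
      via-ab : ∀ x y → C⁻ x a ≡ true → C⁻ b y ≡ true → C x y ≡ true
      via-ab x y p q = Walk⇒connected S F x y (walk-++ (undelete (connected⇒Walk S (F - e) x a p))
        ((e , e-usable , inj₁ (refl , refl)) ∷ undelete (connected⇒Walk S (F - e) b y q)))
      via-ba : ∀ x y → C⁻ x b ≡ true → C⁻ a y ≡ true → C x y ≡ true
      via-ba x y p q = Walk⇒connected S F x y (walk-++ (undelete (connected⇒Walk S (F - e) x b p))
        ((e , e-usable , inj₂ (refl , refl)) ∷ undelete (connected⇒Walk S (F - e) a y q)))
      uses-e : ∀ x y → C x y ≡ true →
        C⁻ x y ≡ true ⊎ ((C⁻ x a ≡ true × C⁻ b y ≡ true) ⊎ (C⁻ x b ≡ true × C⁻ a y ≡ true))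
      uses-e x y p with split (connected⇒Walk S F x y p)
      ... | inj₁ q = inj₁ (Walk⇒connected S (F - e) x y q)
      ... | inj₂ (inj₁ (q , r)) = inj₂ (inj₁ (Walk⇒connected S (F - e) x a q , Walk⇒connected S (F - e) b y r))
      ... | inj₂ (inj₂ (q , r)) = inj₂ (inj₂ (Walk⇒connected S (F - e) x b q , Walk⇒connected S (F - e) a y r))

    components-delete-nonbridge : C⁻ a b ≡ true → components G S (F - e) ≡ components G S F
    components-delete-nonbridge a∼b = Classes.classes-cong (lookup S) λ x y → ≡true-ext
      (C⁻⇒C x y) (λ p → Walk⇒connected S (F - e) x y (avoid-e (split (connected⇒Walk S F x y p))))
      where
      wab = connected⇒Walk S (F - e) a b a∼b
      avoid-e : ∀ {x y} → WalkVia x y → W⁻ x y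
      avoid-e (inj₁ q)             = q
      avoid-e (inj₂ (inj₁ (q , r))) = walk-++ q (walk-++ wab r)
      avoid-e (inj₂ (inj₂ (q , r))) = walk-++ q (walk-++ (walk-reverse wab) r)

    components-delete-≤ : components G S (F - e) ≤ suc (components G S F)
    components-delete-≤ with C⁻ a b in eq
    ... | true  = m≤n⇒m≤1+n (≤-reflexive (components-delete-nonbridge eq))
    ... | false = ≤-reflexive (components-delete-bridge eq)

  components-connected : ∀ F → (∀ u v → connected G ⊤ F u v ≡ true) → Fin n → components G ⊤ F ≡ 1
  components-connected F all-connected v₀ = trans (countF-cong only-r) (countF-≟ r)
    where
    open Classes (lookup {n = n} ⊤)
    C = connected G ⊤ F
    least = least-exists C (connected-refl {⊤} {F}) (connected-sym {⊤} {F}) (connected-trans {⊤} {F}) v₀ (lookup-⊤ v₀)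
    r = proj₁ least
    only-r : ∀ v → isLeast C v ≡ does (v ≟ r)
    only-r v = ≡true-ext
      (λ p → dec-true (v ≟ r) (isLeast-unique C (connected-refl {⊤} {F}) (connected-sym {⊤} {F})
                                  (connected-trans {⊤} {F}) v r p (proj₁ (proj₂ least)) (all-connected v r)))
      (λ q → subst (λ x → isLeast C x ≡ true) (sym (does≡true⇒ (v ≟ r) q)) (proj₁ (proj₂ least)))

  usable⇒endpoints : ∀ S F d x y → usable G S F d ≡ true → joins G d x y → lookup S x ≡ true × lookup S y ≡ true
  usable⇒endpoints S F d x y u (inj₁ (refl , refl)) =
    ∧-elimˡ {lookup S (src d)} (∧-elimʳ {lookup F d} u) , ∧-elimʳ {lookup S (src d)} (∧-elimʳ {lookup F d} u)
  usable⇒endpoints S F d x y u (inj₂ (refl , refl)) =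
    ∧-elimʳ {lookup S (src d)} (∧-elimʳ {lookup F d} u) , ∧-elimˡ {lookup S (src d)} (∧-elimʳ {lookup F d} u)

  Walk-trivial-or-inside : ∀ S F x y → Walk S F x y → x ≡ y ⊎ (lookup S x ≡ true × lookup S y ≡ true)
  Walk-trivial-or-inside S F x y [] = inj₁ refl
  Walk-trivial-or-inside S F x y (_∷_ {y = y'} (d , u , j) w)
    with usable⇒endpoints S F d x y' u j | Walk-trivial-or-inside S F y' y w
  ... | sx , sy' | inj₁ refl    = inj₂ (sx , sy')
  ... | sx , _   | inj₂ (_ , q) = inj₂ (sx , q)

  -- deleting δ(A) isolates each vertex of A and leaves G[V - A] on the rest
  components-∁δ : ∀ A → components G ⊤ (∁ (δ G A)) ≡ ∣ A ∣ + ω G (∁ A)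
  components-∁δ A = begin
      countF (isLeast⊤ C')                           ≡⟨ countF-cong split ⟩
      countF (λ v → lookup A v ∨ isLeast∁ C v)       ≡⟨ countF-∨-disjoint (lookup A) (isLeast∁ C) disjoint ⟩
      countF (lookup A) + countF (isLeast∁ C)        ≡⟨ cong (_+ countF (isLeast∁ C)) (sym (∣p∣≡countF A)) ⟩
      ∣ A ∣ + ω G (∁ A)                                ∎
    where
    open ≡-Reasoning
    open Classes (lookup {n = n} ⊤) using () renaming (isLeast to isLeast⊤; isLeast-intro to isLeast⊤-intro;
      isLeast-minimal to isLeast⊤-minimal)
    open Classes (lookup (∁ A)) using () renaming (isLeast to isLeast∁; isLeast-intro to isLeast∁-intro;
      isLeast-minimal to isLeast∁-minimal; isLeast⇒s to isLeast∁⇒∉A)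
    C' = connected G ⊤ (∁ (δ G A))
    C = connected G (∁ A) ⊤
    same-usable : ∀ e → usable G ⊤ (∁ (δ G A)) e ≡ usable G (∁ A) ⊤ e
    same-usable e rewrite lookup-∁ (δ G A) e | lookup∘tabulate (λ e → lookup A (src e) ∨ lookup A (tgt e)) e
      | lookup-⊤ (src e) | lookup-⊤ (tgt e) | lookup-⊤ e | lookup-∁ A (src e) | lookup-∁ A (tgt e)
      with lookup A (src e) | lookup A (tgt e)
    ... | true  | _     = refl
    ... | false | true  = refl
    ... | false | false = refl
    C'≡C : ∀ x y → C' x y ≡ C x y
    C'≡C = connected-cong ⊤ (∁ (δ G A)) (∁ A) ⊤ same-usable
    ∈A⇒∉∁A : ∀ v → lookup A v ≡ true → lookup (∁ A) v ≡ true → ⊥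
    ∈A⇒∉∁A v p q rewrite lookup-∁ A v | p = true≢false q refl
    split : ∀ v → isLeast⊤ C' v ≡ (lookup A v ∨ isLeast∁ C v)
    split v = ≡true-ext to from
      where
      to : isLeast⊤ C' v ≡ true → (lookup A v ∨ isLeast∁ C v) ≡ true
      to p with lookup A v in av
      ... | true  = refl
      ... | false = isLeast∁-intro C v (trans (lookup-∁ A v) (cong not av)) λ w lt _ cw →
              isLeast⊤-minimal C' v w p lt (lookup-⊤ w) (trans (C'≡C w v) cw)
      from : (lookup A v ∨ isLeast∁ C v) ≡ true → isLeast⊤ C' v ≡ true
      from q = isLeast⊤-intro C' v (lookup-⊤ v) λ w lt _ cw → excluded w lt (trans (sym (C'≡C w v)) cw) (∨-elim q)
        where
        excluded : ∀ w → toℕ w < toℕ v → C w v ≡ true → (lookup A v ≡ true ⊎ isLeast∁ C v ≡ true) → ⊥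
        excluded w lt cw r with Walk-trivial-or-inside (∁ A) ⊤ w v (connected⇒Walk (∁ A) ⊤ w v cw)
        ... | inj₁ refl = <-irrefl refl lt
        ... | inj₂ (sw , sv) with r
        ...   | inj₁ av = ∈A⇒∉∁A v av sv
        ...   | inj₂ rv = isLeast∁-minimal C v w rv lt sw cw
    disjoint : ∀ v → (lookup A v ∧ isLeast∁ C v) ≡ false
    disjoint v with lookup A v in av | isLeast∁ C v in rv
    ... | false | _     = refl
    ... | true  | false = refl
    ... | true  | true  = ⊥-elim (∈A⇒∉∁A v av (isLeast∁⇒∉A C v rv))

  lookup-∷ʳ≡lookup-∷-nextF : ∀ {a} {X : Set a} {k} (v : X) (vs : Vec X k) i →
    lookup (vs ∷ʳ v) i ≡ lookup (v ∷ vs) (nextF G i)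
  lookup-∷ʳ≡lookup-∷-nextF v []       zero    = refl
  lookup-∷ʳ≡lookup-∷-nextF v (u ∷ ws) zero    = refl
  lookup-∷ʳ≡lookup-∷-nextF v (u ∷ ws) (suc i) with nextF G i | lookup-∷ʳ≡lookup-∷-nextF v ws i
  ... | zero  | ih = ih
  ... | suc j | ih = ih

  module _ {S : Subset n} {F : Subset m} where

    length : ∀ {x y} → Walk S F x y → ℕ
    length []      = 0
    length (_ ∷ w) = suc (length w)

    vertices : ∀ {x y} (w : Walk S F x y) → Vec (Fin n) (suc (length w))
    vertices {x} []      = x ∷ []
    vertices {x} (_ ∷ w) = x ∷ vertices w

    vertices-head : ∀ {x y} (w : Walk S F x y) → lookup (vertices w) zero ≡ x
    vertices-head []      = refl
    vertices-head (_ ∷ w) = refl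

    Simple : ∀ {x y} → Walk S F x y → Set
    Simple []          = Unit
    Simple {x} (_ ∷ w) = (∀ i → lookup (vertices w) i ≢ x) × Simple w

    suffix : ∀ {x y z} (w : Walk S F x y) → Simple w → (i : Fin (suc (length w))) → lookup (vertices w) i ≡ z →
      Σ (Walk S F z y) Simple
    suffix w sw zero eq with trans (sym (vertices-head w)) eq
    ... | refl = w , sw
    suffix (_ ∷ w) (_ , sw) (suc i) eq = suffix w sw i eq

    shortcut : ∀ {x y} → Walk S F x y → Σ (Walk S F x y) Simple
    shortcut []      = [] , tt
    shortcut {x} (a ∷ w) with shortcut w
    ... | p , sp with any? (λ i → lookup (vertices p) i ≟ x)
    ... | yes (i , eq) = suffix p sp i eq
    ... | no x∉        = a ∷ p , (λ i eq → x∉ (i , eq)) , sp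

    vertices-injective : ∀ {x y} (w : Walk S F x y) → Simple w → ∀ {i j} →
      lookup (vertices w) i ≡ lookup (vertices w) j → i ≡ j
    vertices-injective []      _        {zero}  {zero}  eq = refl
    vertices-injective (_ ∷ w) _        {zero}  {zero}  eq = refl
    vertices-injective (_ ∷ w) (x∉ , _) {zero}  {suc j} eq = ⊥-elim (x∉ j (sym eq))
    vertices-injective (_ ∷ w) (x∉ , _) {suc i} {zero}  eq = ⊥-elim (x∉ i eq)
    vertices-injective (_ ∷ w) (_ , sw) {suc i} {suc j} eq = cong suc (vertices-injective w sw eq)

    vertices∈S : ∀ {x y} (w : Walk S F x y) → lookup S y ≡ true → ∀ i → lookup S (lookup (vertices w) i) ≡ true
    vertices∈S []                               y∈S zero    = y∈S
    vertices∈S {x} (_∷_ {y = x'} (d , u , j) w) y∈S zero    = proj₁ (usable⇒endpoints S F d x x' u j)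
    vertices∈S (_ ∷ w)                          y∈S (suc i) = vertices∈S w y∈S i

    edgesThen : ∀ {x y} (w : Walk S F x y) → Fin m → Vec (Fin m) (suc (length w))
    edgesThen []              e = e ∷ []
    edgesThen ((d , _) ∷ w) e = d ∷ edgesThen w e

    successors : ∀ {x y} (w : Walk S F x y) → Fin n → Vec (Fin n) (suc (length w))
    successors []                   z = z ∷ []
    successors (_∷_ {y = x'} _ w) z = x' ∷ successors w z

    successors-closed : ∀ {x y} (w : Walk S F x y) i → lookup (successors w x) i ≡ lookup (vertices w) (nextF G i)
    successors-closed {x} []      zero = refl
    successors-closed {x} (_ ∷ w) i =
      trans (cong (λ v → lookup v i) (successors≡ w x)) (lookup-∷ʳ≡lookup-∷-nextF x (vertices w) i)
      where
      successors≡ : ∀ {x' y} (w : Walk S F x' y) z → x' ∷ successors w z ≡ vertices w ∷ʳ z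
      successors≡ []      z = refl
      successors≡ (_ ∷ w) z = cong (_ ∷_) (successors≡ w z)

    edgesThen-join : ∀ {x y} (w : Walk S F x y) e z → joins G e y z →
      ∀ i → joins G (lookup (edgesThen w e) i) (lookup (vertices w) i) (lookup (successors w z) i)
    edgesThen-join []                e z je zero    = je
    edgesThen-join ((_ , _ , j) ∷ w) e z je zero    = j
    edgesThen-join (_ ∷ w)           e z je (suc i) = edgesThen-join w e z je i

    OnWalk : ∀ {x y} → Walk S F x y → Fin n → Set
    OnWalk w v = ∃[ i ] lookup (vertices w) i ≡ v

    endpoints-on-walk : ∀ {x y} (w : Walk S F x y) e j → lookup (edgesThen w e) j ≡ e ⊎
      (OnWalk w (src (lookup (edgesThen w e) j)) × OnWalk w (tgt (lookup (edgesThen w e) j)))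
    endpoints-on-walk []      e zero = inj₁ refl
    endpoints-on-walk {x} (_∷_ {y = x'} (d , u , jn) w) e zero = inj₂ (on (src-end jn) , on (tgt-end jn))
      where
      src-end : joins G d x x' → (src d ≡ x) ⊎ (src d ≡ x')
      src-end (inj₁ (s , _)) = inj₁ s
      src-end (inj₂ (s , _)) = inj₂ s
      tgt-end : joins G d x x' → (tgt d ≡ x) ⊎ (tgt d ≡ x')
      tgt-end (inj₁ (_ , t)) = inj₂ t
      tgt-end (inj₂ (_ , t)) = inj₁ t
      on : ∀ {v} → (v ≡ x) ⊎ (v ≡ x') → OnWalk ((d , u , jn) ∷ w) v
      on (inj₁ refl) = zero , refl
      on (inj₂ refl) = suc zero , vertices-head w
    endpoints-on-walk (_ ∷ w) e (suc j) with endpoints-on-walk w e j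
    ... | inj₁ q = inj₁ q
    ... | inj₂ ((i₁ , q₁) , (i₂ , q₂)) = inj₂ ((suc i₁ , q₁) , (suc i₂ , q₂))

    first-edge-new : ∀ {x x' y} (a : Adjacent S F x x') (w : Walk S F x' y) {e} → lookup F e ≡ false →
      (∀ i → lookup (vertices w) i ≢ x) → ∀ j → lookup (edgesThen w e) j ≢ proj₁ a
    first-edge-new (d , u , jn) w {e} e∉F x∉ j eq with endpoints-on-walk w e j
    ... | inj₁ q = true≢false (∧-elimˡ {lookup F d} u) (subst (λ f → lookup F f ≡ false) (trans (sym q) eq) e∉F)
    ... | inj₂ ((i₁ , q₁) , (i₂ , q₂)) with jn
    ...   | inj₁ (s , _) = x∉ i₁ (trans q₁ (trans (cong src eq) s))
    ...   | inj₂ (_ , t) = x∉ i₂ (trans q₂ (trans (cong tgt eq) t))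

    edgesThen-injective : ∀ {x y} (w : Walk S F x y) e → lookup F e ≡ false → Simple w → ∀ {i j} →
      lookup (edgesThen w e) i ≡ lookup (edgesThen w e) j → i ≡ j
    edgesThen-injective []      e e∉F _        {zero}  {zero}  eq = refl
    edgesThen-injective (_ ∷ w) e e∉F _        {zero}  {zero}  eq = refl
    edgesThen-injective (a ∷ w) e e∉F (x∉ , _) {zero}  {suc j} eq = ⊥-elim (first-edge-new a w e∉F x∉ j (sym eq))
    edgesThen-injective (a ∷ w) e e∉F (x∉ , _) {suc i} {zero}  eq = ⊥-elim (first-edge-new a w e∉F x∉ i eq)
    edgesThen-injective (_ ∷ w) e e∉F (_ , sw) {suc i} {suc j} eq = cong suc (edgesThen-injective w e e∉F sw eq)

  closing-edge⇒cycle : ∀ A F e → lookup F e ≡ false → lookup A (tgt e) ≡ true → Walk A F (src e) (tgt e) → CycleIn G A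
  closing-edge⇒cycle A F e e∉F t∈A w = cycle (shortcut w) refl refl
    where
    cycle : ∀ {x y} → Σ (Walk A F x y) Simple → x ≡ src e → y ≡ tgt e → CycleIn G A
    cycle ([] , _) x≡ y≡ = ⊥-elim (loopless e (trans (sym x≡) y≡))
    cycle (p@(_ ∷ _) , sp) refl refl = record
      { k       = length p
      ; len≥2   = s≤s z≤n
      ; vs      = lookup (vertices p)
      ; es      = lookup (edgesThen p e)
      ; vs-inj  = vertices-injective p sp
      ; es-inj  = edgesThen-injective p e e∉F sp
      ; vs∈A    = λ i → lookup⇒∈ (vertices∈S p t∈A i)
      ; es-join = λ i → subst (joins G (lookup (edgesThen p e) i) (lookup (vertices p) i)) (successors-closed p i)
                          (edgesThen-join p e (src e) (inj₂ (refl , refl)) i)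
      }

  edgesIn : Subset n → Subset m
  edgesIn A = tabulate λ e → lookup A (src e) ∧ lookup A (tgt e)

  Walk-without-edges : ∀ S F → (∀ e → lookup F e ≡ false) → ∀ {x y} → Walk S F x y → x ≡ y
  Walk-without-edges S F no-edge []                = refl
  Walk-without-edges S F no-edge ((d , u , _) ∷ w) = ⊥-elim (true≢false (∧-elimˡ {lookup F d} u) (no-edge d))

  module _ (A : Subset n) (acyclic : Acyclic G A) where

    private
      InsideA : Subset m → Set
      InsideA F = ∀ e → lookup F e ≡ true → (lookup A (src e) ∧ lookup A (tgt e)) ≡ true

      -- removing an edge of F splits a component, since otherwise it would close a cycle
      forest-count : ∀ k F → ∣ F ∣ ≡ k → InsideA F → ∣ F ∣ + components G A F ≡ ∣ A ∣
      forest-count zero F ∣F∣≡0 _ rewrite ∣F∣≡0 = trans (countF-cong isLeast≡A) (sym (∣p∣≡countF A))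
        where
        open Classes (lookup A)
        no-edge = countF≡0⇒false (lookup F) (trans (sym (∣p∣≡countF F)) ∣F∣≡0)
        isLeast≡A : ∀ v → isLeast (connected G A F) v ≡ lookup A v
        isLeast≡A v = ≡true-ext (isLeast⇒s (connected G A F) v) λ v∈A → isLeast-intro (connected G A F) v v∈A
          λ w lt _ cw → <-irrefl (cong toℕ (Walk-without-edges A F no-edge (connected⇒Walk A F w v cw))) lt
      forest-count (suc k) F ∣F∣≡1+k inside = begin
          ∣ F ∣ + components G A F                ≡⟨ cong (_+ components G A F) (∣p∣≡suc∣p-x∣ F e e∈F) ⟩
          suc ∣ F - e ∣ + components G A F        ≡⟨ sym (+-suc ∣ F - e ∣ _) ⟩
          ∣ F - e ∣ + suc (components G A F)      ≡⟨ cong (∣ F - e ∣ +_) (sym splits) ⟩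
          ∣ F - e ∣ + components G A (F - e)      ≡⟨ forest-count k (F - e) ∣F-e∣≡k inside⁻ ⟩
          ∣ A ∣                                    ∎
        where
        open ≡-Reasoning
        e∃ = countF>0⇒∃ (lookup F) (subst (0 <_) (trans (sym ∣F∣≡1+k) (∣p∣≡countF F)) (s≤s z≤n))
        e = proj₁ e∃
        e∈F = proj₂ e∃
        ∣F-e∣≡k : ∣ F - e ∣ ≡ k
        ∣F-e∣≡k = suc-injective (trans (sym (∣p∣≡suc∣p-x∣ F e e∈F)) ∣F∣≡1+k)
        inside⁻ : InsideA (F - e)
        inside⁻ d p = inside d (∧-elimˡ {lookup F d} (trans (sym (lookup-[p-x] F e d)) p))
        e-usable : usable G A F e ≡ true
        e-usable = ∧-intro e∈F (inside e e∈F)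
        ends-separated : connected G A (F - e) (src e) (tgt e) ≡ false
        ends-separated with connected G A (F - e) (src e) (tgt e) in eq
        ... | false = refl
        ... | true  = ⊥-elim (acyclic (closing-edge⇒cycle A (F - e) e (lookup-[p-x]-x F e)
                        (∧-elimʳ {lookup A (src e)} (inside e e∈F)) (connected⇒Walk A (F - e) (src e) (tgt e) eq)))
        splits : components G A (F - e) ≡ suc (components G A F)
        splits = DeleteEdge.components-delete-bridge A F e e-usable ends-separated

    ∣edgesIn∣+ω≡∣A∣ : ∣ edgesIn A ∣ + ω G A ≡ ∣ A ∣
    ∣edgesIn∣+ω≡∣A∣ = begin
        ∣ edgesIn A ∣ + ω G A                       ≡⟨ cong (∣ edgesIn A ∣ +_) (components-cong A ⊤ A (edgesIn A) same-usable (λ _ → refl)) ⟩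
        ∣ edgesIn A ∣ + components G A (edgesIn A)  ≡⟨ forest-count _ (edgesIn A) refl inside ⟩
        ∣ A ∣                                        ∎
      where
      open ≡-Reasoning
      inside : InsideA (edgesIn A)
      inside e p = trans (sym (lookup∘tabulate _ e)) p
      same-usable : ∀ e → usable G A ⊤ e ≡ usable G A (edgesIn A) e
      same-usable e rewrite lookup∘tabulate (λ e → lookup A (src e) ∧ lookup A (tgt e)) e | lookup-⊤ e =
        sym (∧-idem (lookup A (src e) ∧ lookup A (tgt e)))

  ∣δ∣+∣edgesIn∣≡∑degree : ∀ A → ∣ δ G A ∣ + ∣ edgesIn A ∣ ≡ ∑[ v < n ] when (lookup A v) (degree G v)
  ∣δ∣+∣edgesIn∣≡∑degree A = begin
      ∣ δ G A ∣ + ∣ edgesIn A ∣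
    ≡⟨ cong₂ _+_ (trans (∣p∣≡countF (δ G A)) (countF-cong (lookup∘tabulate (λ e → A∋ (src e) ∨ A∋ (tgt e)))))
                 (trans (∣p∣≡countF (edgesIn A)) (countF-cong (lookup∘tabulate (λ e → A∋ (src e) ∧ A∋ (tgt e))))) ⟩
      countF (λ e → A∋ (src e) ∨ A∋ (tgt e)) + countF (λ e → A∋ (src e) ∧ A∋ (tgt e))
    ≡⟨ countF-∨-∧ (A∋ ∘ src) (A∋ ∘ tgt) ⟩
      countF (A∋ ∘ src) + countF (A∋ ∘ tgt)
    ≡⟨ cong₂ _+_ (countF∘≡∑-fibres src A∋) (countF∘≡∑-fibres tgt A∋) ⟩
      ∑[ v < n ] when (A∋ v) (countF (λ e → does (src e ≟ v))) + ∑[ v < n ] when (A∋ v) (countF (λ e → does (tgt e ≟ v)))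
    ≡⟨ sym (∑-distrib-+ (λ v → when (A∋ v) (countF (λ e → does (src e ≟ v))))
                        (λ v → when (A∋ v) (countF (λ e → does (tgt e ≟ v))))) ⟩
      ∑[ v < n ] (when (A∋ v) (countF (λ e → does (src e ≟ v))) + when (A∋ v) (countF (λ e → does (tgt e ≟ v))))
    ≡⟨ sum-cong-≗ (λ v → sym (when-+ (A∋ v) _ _)) ⟩
      ∑[ v < n ] when (A∋ v) (degree G v)
    ∎
    where
    open ≡-Reasoning
    A∋ = lookup A

  ∣δ∣+∣edgesIn∣≡3∣A∣ : Trivalent G → ∀ A → ∣ δ G A ∣ + ∣ edgesIn A ∣ ≡ 3 * ∣ A ∣
  ∣δ∣+∣edgesIn∣≡3∣A∣ trivalent A = begin
    ∣ δ G A ∣ + ∣ edgesIn A ∣                   ≡⟨ ∣δ∣+∣edgesIn∣≡∑degree A ⟩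
    ∑[ v < n ] when (lookup A v) (degree G v)   ≡⟨ ∑-when-const (lookup A) (degree G) 3 trivalent ⟩
    3 * countF (lookup A)                       ≡⟨ cong (3 *_) (sym (∣p∣≡countF A)) ⟩
    3 * ∣ A ∣                                    ∎
    where open ≡-Reasoning

  rank*-insert : ∀ X e → lookup X e ≡ false → rank* G X ≤ rank* G (X ∪ ⁅ e ⁆)
  rank*-insert X e e∉X = ∸-monoˡ-≤ (rank G ⊤) (begin
      ∣ X ∣ + (n ∸ c)                                ≤⟨ +-monoʳ-≤ ∣ X ∣ nullity ⟩
      ∣ X ∣ + suc (rank G (∁ (X ∪ ⁅ e ⁆)))           ≡⟨ +-suc ∣ X ∣ _ ⟩
      suc ∣ X ∣ + rank G (∁ (X ∪ ⁅ e ⁆))             ≡⟨ cong (_+ rank G (∁ (X ∪ ⁅ e ⁆))) (sym (∣p∪⁅x⁆∣≡suc∣p∣ X e e∉X)) ⟩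
      ∣ X ∪ ⁅ e ⁆ ∣ + rank G (∁ (X ∪ ⁅ e ⁆))         ∎)
    where
    open ≤-Reasoning
    c = components G ⊤ (∁ X)
    e-usable : usable G ⊤ (∁ X) e ≡ true
    e-usable rewrite lookup-∁ X e | e∉X | lookup-⊤ (src e) | lookup-⊤ (tgt e) = refl
    components≤ : components G ⊤ (∁ (X ∪ ⁅ e ⁆)) ≤ suc c
    components≤ = subst (λ Z → components G ⊤ Z ≤ suc c) (sym (∁[p∪⁅x⁆]≡∁p-x X e)) (DeleteEdge.components-delete-≤ ⊤ (∁ X) e e-usable)
    nullity : n ∸ c ≤ suc (rank G (∁ (X ∪ ⁅ e ⁆)))
    nullity = m≤n+o⇒m∸n≤o n c (begin
      n                     ≤⟨ m≤n+m∸n n c' ⟩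
      c' + (n ∸ c')         ≤⟨ +-monoˡ-≤ (n ∸ c') components≤ ⟩
      suc c + (n ∸ c')      ≡⟨ sym (+-suc c (n ∸ c')) ⟩
      c + suc (n ∸ c')      ∎)
      where c' = components G ⊤ (∁ (X ∪ ⁅ e ⁆))

  rank*-mono : ∀ {X Y} → X ⊆ Y → rank* G X ≤ rank* G Y
  rank*-mono {X} {Y} X⊆Y = go _ X X⊆Y refl
    where
    missing : Subset m → Fin m → Bool
    missing X x = lookup Y x ∧ not (lookup X x)
    go : ∀ k X → X ⊆ Y → countF (missing X) ≡ k → rank* G X ≤ rank* G Y
    go zero X X⊆Y none-missing = ≤-reflexive (cong (rank* G) (⊆-antisym X⊆Y Y⊆X))
      where
      Y⊆X : Y ⊆ X
      Y⊆X {x} x∈Y with lookup X x in eq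
      ... | true  = lookup⇒∈ eq
      ... | false = ⊥-elim (true≢false (∧-intro (∈⇒lookup x∈Y) (cong not eq))
                                       (countF≡0⇒false (missing X) none-missing x))
    go (suc k) X X⊆Y k+1-missing = ≤-trans (rank*-insert X e e∉X) (go k (X ∪ ⁅ e ⁆) X∪e⊆Y k-missing)
      where
      e∃ = countF>0⇒∃ (missing X) (subst (0 <_) (sym k+1-missing) (s≤s z≤n))
      e = proj₁ e∃
      e∉X : lookup X e ≡ false
      e∉X = not≡true⇒≡false (∧-elimʳ {lookup Y e} (proj₂ e∃))
      X∪e⊆Y : X ∪ ⁅ e ⁆ ⊆ Y
      X∪e⊆Y {x} x∈ with ∨-elim {lookup X x} (trans (sym (lookup-∪⁅⁆ X e x)) (∈⇒lookup x∈))
      ... | inj₁ x∈X = X⊆Y (lookup⇒∈ x∈X)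
      ... | inj₂ x≡e with does≡true⇒ (x ≟ e) x≡e
      ...   | refl = lookup⇒∈ (∧-elimˡ {lookup Y e} (proj₂ e∃))
      k-missing : countF (missing (X ∪ ⁅ e ⁆)) ≡ k
      k-missing = suc-injective (trans (sym (trans (countF-delete (missing X) e (proj₂ e∃)) (cong suc (countF-cong same))))
                                       k+1-missing)
        where
        same : ∀ x → (missing X x ∧ not (does (x ≟ e))) ≡ missing (X ∪ ⁅ e ⁆) x
        same x rewrite lookup-∪⁅⁆ X e x with lookup Y x | lookup X x
        ... | true  | true  = refl
        ... | true  | false = refl
        ... | false | _     = refl

  rank*-⁅⁆ : TwoEdgeConnected G → Fin n → ∀ d → rank* G ⁅ d ⁆ ≡ 1
  rank*-⁅⁆ (connected-G , connected-G-d) v₀ d = begin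
    (∣ ⁅ d ⁆ ∣ + (n ∸ components G ⊤ (∁ ⁅ d ⁆))) ∸ (n ∸ components G ⊤ ⊤)
      ≡⟨ cong₂ _∸_ (cong₂ _+_ (∣⁅x⁆∣≡1 d) (cong (n ∸_) (components-connected (∁ ⁅ d ⁆) (connected-G-d d) v₀)))
                   (cong (n ∸_) (components-connected ⊤ connected-G v₀)) ⟩
    (1 + (n ∸ 1)) ∸ (n ∸ 1)
      ≡⟨ m+n∸n≡m 1 (n ∸ 1) ⟩
    1 ∎
    where open ≡-Reasoning

  ∣δ∣≡2∣A∣+ω : Trivalent G → ∀ A → Acyclic G A → ∣ δ G A ∣ ≡ ∣ A ∣ + ∣ A ∣ + ω G A
  ∣δ∣≡2∣A∣+ω trivalent A acyclic = +-cancelʳ-≡ E ∣ δ G A ∣ (a + a + w) (begin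
      ∣ δ G A ∣ + E                ≡⟨ ∣δ∣+∣edgesIn∣≡3∣A∣ trivalent A ⟩
      3 * a                        ≡⟨ cong (3 *_) (sym forest) ⟩
      3 * (E + w)                  ≡⟨ shuffle E w ⟩
      (E + w) + (E + w) + w + E    ≡⟨ cong (λ z → z + z + w + E) forest ⟩
      a + a + w + E                ∎)
    where
    open ≡-Reasoning
    a = ∣ A ∣
    w = ω G A
    E = ∣ edgesIn A ∣
    forest = ∣edgesIn∣+ω≡∣A∣ A acyclic
    shuffle : ∀ E w → 3 * (E + w) ≡ (E + w) + (E + w) + w + E
    shuffle = solve-∀

  rank*-δ : Trivalent G → (∀ u v → connected G ⊤ ⊤ u v ≡ true) → ∀ A → Acyclic G A → Fin n →
    rank* G (δ G A) ≡ suc (∣ A ∣ + ω G A) ∸ ω G (∁ A)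
  rank*-δ trivalent connected-G A acyclic v₀ = begin
      (∣ δ G A ∣ + (n ∸ components G ⊤ (∁ (δ G A)))) ∸ (n ∸ components G ⊤ ⊤)
    ≡⟨ cong₂ _∸_ (cong₂ _+_ (∣δ∣≡2∣A∣+ω trivalent A acyclic) (cong (n ∸_) (components-∁δ A)))
                 (cong (n ∸_) (components-connected ⊤ connected-G v₀)) ⟩
      (∣ A ∣ + ∣ A ∣ + ω G A + (n ∸ (∣ A ∣ + ω G (∁ A)))) ∸ (n ∸ 1)
    ≡⟨ [2a+w+[n∸[a+v]]]∸[n∸1]≡[1+a+w]∸v ∣ A ∣ (ω G A) (ω G (∁ A)) n (>-nonZero⁻¹ n {{nonZeroIndex v₀}})
         (subst (_≤ n) (components-∁δ A) (components≤n ⊤ (∁ (δ G A)))) ⟩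
      suc (∣ A ∣ + ω G A) ∸ ω G (∁ A)
    ∎
    where open ≡-Reasoning

  Cond⇔ω<ω∁ : Trivalent G → (∀ u v → connected G ⊤ ⊤ u v ≡ true) → ∀ A → Acyclic G A → Fin n →
    Cond G A ⇔ ω G A < ω G (∁ A)
  Cond⇔ω<ω∁ trivalent connected-G A acyclic v₀ =
    subst (λ r → r ≤ ∣ A ∣ ⇔ ω G A < ω G (∁ A)) (sym (rank*-δ trivalent connected-G A acyclic v₀))
          ([1+m+n]∸o≤m⇔n<o ∣ A ∣ (ω G A) (ω G (∁ A)))

  Acyclic-⊆ : ∀ {A B} → B ⊆ A → Acyclic G A → Acyclic G B
  Acyclic-⊆ B⊆A acyclic c = acyclic (record
    { k = CycleIn.k c ; len≥2 = CycleIn.len≥2 c ; vs = CycleIn.vs c ; es = CycleIn.es c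
    ; vs-inj = CycleIn.vs-inj c ; es-inj = CycleIn.es-inj c
    ; vs∈A = λ i → B⊆A (CycleIn.vs∈A c i) ; es-join = CycleIn.es-join c })

  δ-mono : ∀ {A B} → B ⊆ A → δ G B ⊆ δ G A
  δ-mono {A} {B} B⊆A {x} x∈δB
    with ∨-elim {lookup B (src x)} (trans (sym (lookup∘tabulate _ x)) (∈⇒lookup x∈δB))
  ... | inj₁ p = lookup⇒∈ (trans (lookup∘tabulate _ x) (∨-introˡ (∈⇒lookup (B⊆A (lookup⇒∈ p)))))
  ... | inj₂ p = lookup⇒∈ (trans (lookup∘tabulate _ x) (∨-introʳ {lookup A (src x)} (∈⇒lookup (B⊆A (lookup⇒∈ p)))))

  incident-edge : Trivalent G → ∀ v → ∃[ d ] (src d ≡ v ⊎ tgt d ≡ v)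
  incident-edge trivalent v with countF (λ e → does (src e ≟ v)) in eq
  ... | suc _ = let (d , p) = countF>0⇒∃ (λ e → does (src e ≟ v)) (subst (0 <_) (sym eq) (s≤s z≤n))
                in d , inj₁ (does≡true⇒ (src d ≟ v) p)
  ... | zero  = let (d , p) = countF>0⇒∃ (λ e → does (tgt e ≟ v))
                               (subst (0 <_) (sym (trans (cong (_+ countF (λ e → does (tgt e ≟ v))) (sym eq)) (trivalent v))) (s≤s z≤n))
                in d , inj₂ (does≡true⇒ (tgt d ≟ v) p)

  1≤rank*δ : Trivalent G → TwoEdgeConnected G → ∀ A → Nonempty A → 1 ≤ rank* G (δ G A)
  1≤rank*δ trivalent two-edge-connected A (v , v∈A) =
    subst (_≤ rank* G (δ G A)) (rank*-⁅⁆ two-edge-connected v d) (rank*-mono ⁅d⁆⊆δA)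
    where
    d∃ = incident-edge trivalent v
    d = proj₁ d∃
    ⁅d⁆⊆δA : ⁅ d ⁆ ⊆ δ G A
    ⁅d⁆⊆δA {x} x∈⁅d⁆ with x∈⁅y⁆⇒x≡y d x∈⁅d⁆
    ... | refl = lookup⇒∈ (trans (lookup∘tabulate _ d) (end-in-A (proj₂ d∃)))
      where
      end-in-A : src d ≡ v ⊎ tgt d ≡ v → (lookup A (src d) ∨ lookup A (tgt d)) ≡ true
      end-in-A (inj₁ s) = ∨-introˡ (subst (λ u → lookup A u ≡ true) (sym s) (∈⇒lookup v∈A))
      end-in-A (inj₂ t) = ∨-introʳ {lookup A (src d)} (subst (λ u → lookup A u ≡ true) (sym t) (∈⇒lookup v∈A))

  -- if ω(V - A) ≥ ω(A) + 2, then A minus one vertex still satisfies Cond, against minimality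
  circuit⇒ω+1≡ω∁ : Trivalent G → TwoEdgeConnected G → ∀ A → Acyclic G A → IsCircuit G A → ω G A + 1 ≡ ω G (∁ A)
  circuit⇒ω+1≡ω∁ trivalent two-edge-connected A acyclic (A≠∅@(v₀ , v₀∈A) , cond , minimal) =
    trans (+-comm (ω G A) 1) (≤-antisym w<v (≮⇒≥ two-more))
    where
    a' = ∣ A - v₀ ∣
    w<v = Equivalence.to (Cond⇔ω<ω∁ trivalent (proj₁ two-edge-connected) A acyclic v₀) cond
    two-more : ¬ (suc (ω G A) < ω G (∁ A))
    two-more 1+w<v = smaller-set (nonempty? (A - v₀))
      where
      rank*≤a' : rank* G (δ G A) ≤ a'
      rank*≤a' = subst (_≤ a') (sym (begin
        rank* G (δ G A)                       ≡⟨ rank*-δ trivalent (proj₁ two-edge-connected) A acyclic v₀ ⟩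
        suc (∣ A ∣ + ω G A) ∸ ω G (∁ A)        ≡⟨ cong (λ s → suc (s + ω G A) ∸ ω G (∁ A)) (∣p∣≡suc∣p-x∣ A v₀ (∈⇒lookup v₀∈A)) ⟩
        suc (suc a' + ω G A) ∸ ω G (∁ A)       ≡⟨ cong (λ s → suc s ∸ ω G (∁ A)) (sym (+-suc a' (ω G A))) ⟩
        suc (a' + suc (ω G A)) ∸ ω G (∁ A)     ∎))
        (Equivalence.from ([1+m+n]∸o≤m⇔n<o a' (suc (ω G A)) (ω G (∁ A))) 1+w<v)
        where open ≡-Reasoning
      smaller-set : Dec (Nonempty (A - v₀)) → ⊥
      smaller-set (yes A-v₀≠∅) = true≢false (∈⇒lookup v₀∈A) (subst (λ B → lookup B v₀ ≡ false) A-v₀≡A (lookup-[p-x]-x A v₀))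
        where
        A-v₀≡A = minimal (A - v₀) A-v₀≠∅ (p─q⊆p A ⁅ v₀ ⁆)
                   (≤-trans (rank*-mono (δ-mono (p─q⊆p A ⁅ v₀ ⁆))) rank*≤a')
      smaller-set (no A-v₀=∅) = <⇒≱ (≤-trans (1≤rank*δ trivalent two-edge-connected A A≠∅) rank*≤a')
        (≤-reflexive (trans (cong ∣_∣ (Empty-unique A-v₀=∅)) (∣⊥∣≡0 n)))

proposition3p3 : (G : Graph) → Trivalent G → TwoEdgeConnected G →
    (A : Subset (Graph.n G)) → Acyclic G A →
    ((Dependent G A ⇔ (∃[ A' ] (Nonempty A' × A' ⊆ A × ω G A' < ω G (∁ A'))))
      × (IsCircuit G A → ω G A + 1 ≡ ω G (∁ A)))
    × (Independent G A ⇔ (∀ A' → Nonempty A' → A' ⊆ A → ω G A' ≥ ω G (∁ A')))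
proposition3p3 G trivalent two-edge-connected A acyclic =
  (mk⇔ dependent⇒ ⇒dependent , circuit⇒ω+1≡ω∁ G trivalent two-edge-connected A acyclic) ,
  mk⇔ independent⇒ ⇒independent
  where
  Cond⇔ : ∀ {B} → B ⊆ A → Nonempty B → Cond G B ⇔ ω G B < ω G (∁ B)
  Cond⇔ B⊆A (v , _) = Cond⇔ω<ω∁ G trivalent (proj₁ two-edge-connected) _ (Acyclic-⊆ G B⊆A acyclic) v
  dependent⇒ : Dependent G A → ∃[ A' ] (Nonempty A' × A' ⊆ A × ω G A' < ω G (∁ A'))
  dependent⇒ (C , C⊆A , C≠∅ , cond , _) = C , C≠∅ , C⊆A , Equivalence.to (Cond⇔ C⊆A C≠∅) cond
  ⇒dependent : ∃[ A' ] (Nonempty A' × A' ⊆ A × ω G A' < ω G (∁ A')) → Dependent G A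
  ⇒dependent (A' , A'≠∅ , A'⊆A , lt) =
    let (C , C⊆A' , circuit) = minimal-⊆ (λ B → rank* G (δ G B) ≤? ∣ B ∣) A' A'≠∅ (Equivalence.from (Cond⇔ A'⊆A A'≠∅) lt)
    in C , (λ x∈C → A'⊆A (C⊆A' x∈C)) , circuit
  independent⇒ : Independent G A → ∀ A' → Nonempty A' → A' ⊆ A → ω G A' ≥ ω G (∁ A')
  independent⇒ independent A' A'≠∅ A'⊆A = ≮⇒≥ λ lt → independent (⇒dependent (A' , A'≠∅ , A'⊆A , lt))
  ⇒independent : (∀ A' → Nonempty A' → A' ⊆ A → ω G A' ≥ ω G (∁ A')) → Independent G A
  ⇒independent all-≥ dependent with dependent⇒ dependent
  ... | A' , A'≠∅ , A'⊆A , lt = <⇒≱ lt (all-≥ A' A'≠∅ A'⊆A)
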